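{- Let $k\ge 5$ and let $t$ be an integer with $1\le t<\sqrt{(k-1)/2}$. Let $G$ be a triangle-free graph on $2k-1$ vertices such that every set of $k$ vertices of $G$ spans at least $t+1$ edges. Then $e(G)\le (k-1)^2-t^2+1$.
   Context: $e(G)$ is the number of edges of $G$. -}

module Defs where

open import Data.Nat using (ℕ; _+_; _<ᵇ_)
open import Data.Bool using (Bool; true; false; _∧_; if_then_else_)
open import Data.Fin using (Fin; toℕ)
open import Data.Fin.Subset using (Subset; ⊤)
open import Data.Vec using (lookup)
open import Data.List using (List; allFin; map)
open import Data.Nat.ListAction using (sum)
open import Data.Product using (Σ; _×_)
open import Relation.Binary.PropositionalEquality using (_≡_)
open import Relation.Nullary using (¬_)

record Graph (n : ℕ) : Set where
  field
    adj   : Fin n → Fin n → Bool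
    sym   : ∀ i j → adj i j ≡ adj j i
    irrefl : ∀ i → adj i i ≡ false
open Graph public

edgesIn : ∀ {n} → Graph n → Subset n → ℕ
edgesIn {n} G S =
  sum (map (λ i → sum (map (λ j →
      if (toℕ i <ᵇ toℕ j) ∧ lookup S i ∧ lookup S j ∧ adj G i j then 1 else 0)
    (allFin n))) (allFin n))

e : ∀ {n} → Graph n → ℕ
e {n} G = edgesIn G ⊤

TriangleFree : ∀ {n} → Graph n → Set
TriangleFree {n} G =
  ∀ (a b c : Fin n) → ¬ (adj G a b ≡ true × adj G b c ≡ true × adj G a c ≡ true)

module Submission where

-- Independent sets have at most K vertices, so Δ(G) ≤ K; if Δ(G) < K the
-- handshake lemma suffices.  Otherwise take v of degree K, I = N(v)
-- (independent, |I| = K) and J the other K + 1 vertices.  Each y ∈ J has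
-- a y > t neighbours in I, adjacent y, z have a y + a z ≤ K, and for every
-- independent T ⊆ J we have e(G) ≤ ∑_T a + ∑_{J ∖ T} deg.  Taking for T the
-- J-neighbourhood of a vertex of J-degree > t (case A), two independent
-- ends of disjoint edges of J (case B), or the other J-neighbours of an
-- edge yz meeting all edges of J (case C) reduces the claim to arithmetic.

open import Defs hiding (sym)
open import Data.Nat using (ℕ; zero; suc; _+_; _*_; _∸_; _≤_; _<_; z≤n; s≤s; pred; _≤?_; _<ᵇ_)
open import Data.Nat.Properties hiding (_≟_)
open import Data.Nat.ListAction using () renaming (sum to listSum)
open import Data.Nat.Tactic.RingSolver using (solve-∀)
open import Data.Bool using (Bool; true; false; _∧_; _∨_; not; if_then_else_)
open import Data.Bool.Properties using (∧-zeroʳ; ∨-zeroʳ; ¬-not) renaming (_≟_ to _≟ᵇ_)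
open import Data.Fin using (Fin; zero; suc; toℕ; _≟_)
open import Data.Fin.Properties using (toℕ-injective; any?)
open import Data.Fin.Subset using (Subset; ∣_∣; ⊤)
open import Data.List using (allFin; tabulate) renaming (map to mapList)
open import Data.List.Properties using (map-tabulate)
open import Data.Vec using (lookup; []; _∷_) renaming (tabulate to tabulateᵛ)
open import Data.Vec.Properties using (lookup-replicate; lookup∘tabulate)
open import Data.Product using (Σ; _×_; _,_; proj₁; proj₂; ∃₂)
open import Data.Sum using (_⊎_; inj₁; inj₂)
open import Data.Empty using (⊥; ⊥-elim)
open import Relation.Nullary using (¬_; yes; no; does; contradiction)
open import Relation.Nullary.Decidable using (_×-dec_)
open import Relation.Nullary.Reflects using (ofʸ; ofⁿ)
open import Relation.Binary.PropositionalEquality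
  using (_≡_; refl; sym; trans; cong; cong₂; subst; module ≡-Reasoning)
open import Algebra.Properties.Semiring.Sum +-*-semiring
  using (sum; ∑-distrib-+; ∑-comm; sum-cong-≗; sum-replicate-zero; *-distribˡ-sum; *-distribʳ-sum)

𝟙 : Bool → ℕ
𝟙 true  = 1
𝟙 false = 0

VSet : ℕ → Set
VSet n = Fin n → Bool

private variable n : ℕ

module _ {n : ℕ} where

  infix 4 _∈_ _⊆_
  infixr 6 _∖_ _∪_ _∩_

  _∈_ : Fin n → VSet n → Set
  i ∈ P = P i ≡ true

  _⊆_ : VSet n → VSet n → Set
  Q ⊆ P = ∀ i → i ∈ Q → i ∈ P

  everything : VSet n
  everything _ = true

  ｛_｝ : Fin n → VSet n
  ｛ y ｝ i = does (i ≟ y)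

  _∖_ _∪_ _∩_ : VSet n → VSet n → VSet n
  (P ∖ Q) i = P i ∧ not (Q i)
  (P ∪ Q) i = P i ∨ Q i
  (P ∩ Q) i = P i ∧ Q i

  sumOver : VSet n → (Fin n → ℕ) → ℕ
  sumOver P f = sum (λ i → 𝟙 (P i) * f i)

  card : VSet n → ℕ
  card P = sumOver P (λ _ → 1)

  -- P is the disjoint union of Q and R.  (A record, so that P, Q and R
  -- can be inferred from a proof of it.)
  infix 4 _≐_⊔_
  record _≐_⊔_ (P Q R : VSet n) : Set where
    constructor mk≐
    field split : ∀ i → 𝟙 (P i) ≡ 𝟙 (Q i) + 𝟙 (R i)

∧-true : ∀ {a b} → a ∧ b ≡ true → a ≡ true × b ≡ true
∧-true {true} b≡true = refl , b≡true

∧-intro : ∀ {a b} → a ≡ true → b ≡ true → a ∧ b ≡ true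
∧-intro refl refl = refl

∈-singleton : {i c : Fin n} → i ∈ ｛ c ｝ → i ≡ c
∈-singleton {i = i} {c} i∈c with i ≟ c
... | yes i≡c = i≡c
... | no  _   = contradiction i∈c λ ()

self-∈-singleton : (c : Fin n) → c ∈ ｛ c ｝
self-∈-singleton c with c ≟ c
... | yes _   = refl
... | no  c≢c = contradiction refl c≢c

∈-∩⁻ : {i : Fin n} {P Q : VSet n} → i ∈ P ∩ Q → i ∈ P × i ∈ Q
∈-∩⁻ = ∧-true

∈-∪⁻ : {i : Fin n} {P Q : VSet n} → i ∈ P ∪ Q → i ∈ P ⊎ i ∈ Q
∈-∪⁻ {i = i} {P} i∈P∪Q with P i
... | true  = inj₁ refl
... | false = inj₂ i∈P∪Q

∈-∖ : {i : Fin n} {P Q : VSet n} → i ∈ P → ¬ i ∈ Q → i ∈ P ∖ Q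
∈-∖ {i = i} {P} {Q} i∈P i∉Q rewrite i∈P | ¬-not i∉Q = refl

∈-∖⁻ : {i : Fin n} {P Q : VSet n} → i ∈ P ∖ Q → i ∈ P × ¬ i ∈ Q
∈-∖⁻ {i = i} {P} {Q} i∈P∖Q with P i | Q i
... | true | false = refl , λ ()

∈-∖-singleton : {i c : Fin n} {P : VSet n} → i ∈ P → ¬ i ≡ c → i ∈ P ∖ ｛ c ｝
∈-∖-singleton {c = c} {P} i∈P i≢c = ∈-∖ {P = P} {｛ c ｝} i∈P (λ i∈c → i≢c (∈-singleton i∈c))

∈-∖-singleton⁻ : {i c : Fin n} {P : VSet n} → i ∈ P ∖ ｛ c ｝ → i ∈ P × ¬ i ≡ c
∈-∖-singleton⁻ {i = i} {c} {P} i∈P∖c with ∈-∖⁻ {P = P} {｛ c ｝} i∈P∖c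
... | i∈P , i∉c = i∈P , λ { refl → i∉c (self-∈-singleton c) }

singleton-⊆ : {c : Fin n} {P : VSet n} → c ∈ P → ｛ c ｝ ⊆ P
singleton-⊆ {P = P} c∈P i i∈c = subst (λ x → x ∈ P) (sym (∈-singleton i∈c)) c∈P

∩-⊆ˡ : {P Q : VSet n} → P ∩ Q ⊆ P
∩-⊆ˡ {P = P} {Q} i i∈P∩Q = proj₁ (∈-∩⁻ {P = P} {Q} i∈P∩Q)

∩-⊆ʳ : {P Q : VSet n} → P ∩ Q ⊆ Q
∩-⊆ʳ {P = P} {Q} i i∈P∩Q = proj₂ (∈-∩⁻ {P = P} {Q} i∈P∩Q)

∪-⊆ˡ : {P Q : VSet n} → P ⊆ P ∪ Q
∪-⊆ˡ i i∈P rewrite i∈P = refl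

∪-⊆ʳ : {P Q : VSet n} → Q ⊆ P ∪ Q
∪-⊆ʳ {P = P} i i∈Q rewrite i∈Q = ∨-zeroʳ (P i)

∪-∖-⊆ : {P Q : VSet n} → (P ∪ Q) ∖ Q ⊆ P
∪-∖-⊆ {P = P} {Q} i i∈ with ∈-∖⁻ {P = P ∪ Q} {Q} i∈
... | i∈P∪Q , i∉Q with ∈-∪⁻ {P = P} {Q} i∈P∪Q
...   | inj₁ i∈P = i∈P
...   | inj₂ i∈Q = contradiction i∈Q i∉Q

∈-pair⁻ : {i y z : Fin n} → i ∈ ｛ y ｝ ∪ ｛ z ｝ → i ≡ y ⊎ i ≡ z
∈-pair⁻ {i = i} {y} {z} i∈yz with ∈-∪⁻ {i = i} {｛ y ｝} {｛ z ｝} i∈yz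
... | inj₁ i∈y = inj₁ (∈-singleton {i = i} {y} i∈y)
... | inj₂ i∈z = inj₂ (∈-singleton {i = i} {z} i∈z)

∉-pair : {i y z : Fin n} → ¬ i ≡ y → ¬ i ≡ z → ¬ i ∈ ｛ y ｝ ∪ ｛ z ｝
∉-pair {i = i} {y} {z} i≢y i≢z i∈yz with ∈-pair⁻ {i = i} {y} {z} i∈yz
... | inj₁ i≡y = i≢y i≡y
... | inj₂ i≡z = i≢z i≡z

∉-pair⁻ : {i y z : Fin n} → ¬ i ∈ ｛ y ｝ ∪ ｛ z ｝ → ¬ i ≡ y × ¬ i ≡ z
∉-pair⁻ {y = y} {z} i∉yz =
  (λ { refl → i∉yz (∪-⊆ˡ {P = ｛ y ｝} {｛ z ｝} y (self-∈-singleton y)) }) ,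
  (λ { refl → i∉yz (∪-⊆ʳ {P = ｛ y ｝} {｛ z ｝} z (self-∈-singleton z)) })

pair-⊆ : {y z : Fin n} {P : VSet n} → y ∈ P → z ∈ P → ｛ y ｝ ∪ ｛ z ｝ ⊆ P
pair-⊆ {y = y} {z} y∈P z∈P i i∈yz with ∈-pair⁻ {i = i} {y} {z} i∈yz
... | inj₁ refl = y∈P
... | inj₂ refl = z∈P

sum-mono : ∀ {m} {f g : Fin m → ℕ} → (∀ i → f i ≤ g i) → sum f ≤ sum g
sum-mono {zero}  f≤g = z≤n
sum-mono {suc m} f≤g = +-mono-≤ (f≤g zero) (sum-mono (λ i → f≤g (suc i)))

sum-zero : ∀ {m} {f : Fin m → ℕ} → (∀ i → f i ≡ 0) → sum f ≡ 0
sum-zero {m} f≡0 = trans (sum-cong-≗ f≡0) (sum-replicate-zero m)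

sumOver-cong : ∀ (P : VSet n) {f g : Fin n → ℕ} → (∀ i → f i ≡ g i) → sumOver P f ≡ sumOver P g
sumOver-cong P f≡g = sum-cong-≗ (λ i → cong (𝟙 (P i) *_) (f≡g i))

sumOver-+ : ∀ (P : VSet n) f g → sumOver P (λ i → f i + g i) ≡ sumOver P f + sumOver P g
sumOver-+ P f g =
  trans (sum-cong-≗ (λ i → *-distribˡ-+ (𝟙 (P i)) (f i) (g i)))
        (∑-distrib-+ (λ i → 𝟙 (P i) * f i) (λ i → 𝟙 (P i) * g i))

sumOver-split : {P Q R : VSet n} → P ≐ Q ⊔ R →
  ∀ f → sumOver P f ≡ sumOver Q f + sumOver R f
sumOver-split {P = P} {Q} {R} (mk≐ split) f = begin
  sum (λ i → 𝟙 (P i) * f i)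
    ≡⟨ sum-cong-≗ (λ i → trans (cong (_* f i) (split i)) (*-distribʳ-+ (f i) (𝟙 (Q i)) (𝟙 (R i)))) ⟩
  sum (λ i → 𝟙 (Q i) * f i + 𝟙 (R i) * f i)
    ≡⟨ ∑-distrib-+ (λ i → 𝟙 (Q i) * f i) (λ i → 𝟙 (R i) * f i) ⟩
  sumOver Q f + sumOver R f ∎
  where open ≡-Reasoning

sumOver-mono : {P : VSet n} {f g : Fin n → ℕ} →
  (∀ i → i ∈ P → f i ≤ g i) → sumOver P f ≤ sumOver P g
sumOver-mono {P = P} {f} {g} f≤g = sum-mono pointwise
  where
  pointwise : ∀ i → 𝟙 (P i) * f i ≤ 𝟙 (P i) * g i
  pointwise i with P i in i∈P
  ... | true  = +-monoˡ-≤ 0 (f≤g i i∈P)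
  ... | false = z≤n

sumOver-const : ∀ (P : VSet n) c → sumOver P (λ _ → c) ≡ card P * c
sumOver-const P c =
  sym (trans (*-distribʳ-sum c (λ i → 𝟙 (P i) * 1)) (sum-cong-≗ (λ i → cong (_* c) (*-identityʳ (𝟙 (P i))))))

sumOver-bound : (P : VSet n) {f : Fin n → ℕ} (M : ℕ) →
  (∀ i → i ∈ P → f i ≤ M) → sumOver P f ≤ card P * M
sumOver-bound P M f≤M = ≤-trans (sumOver-mono {P = P} f≤M) (≤-reflexive (sumOver-const P M))

sumOver-bound+ : (P : VSet n) {f : Fin n → ℕ} (c M : ℕ) →
  (∀ i → i ∈ P → f i + c ≤ M) → sumOver P f + card P * c ≤ card P * M
sumOver-bound+ P {f} c M f+c≤M = ≤-trans
  (≤-reflexive (sym (trans (sumOver-+ P f (λ _ → c)) (cong (sumOver P f +_) (sumOver-const P c)))))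
  (sumOver-bound P M f+c≤M)

sumOver-singleton : ∀ {n} (y : Fin n) (f : Fin n → ℕ) → sumOver ｛ y ｝ f ≡ f y
sumOver-singleton {suc n} zero f =
  trans (cong₂ _+_ (*-identityˡ (f zero)) (sum-replicate-zero n)) (+-identityʳ (f zero))
sumOver-singleton {suc n} (suc y) f = sumOver-singleton y (λ i → f (suc i))

⊆-split : {Q P : VSet n} → Q ⊆ P → P ≐ Q ⊔ (P ∖ Q)
⊆-split {Q = Q} {P} Q⊆P = mk≐ split
  where
  split : ∀ i → 𝟙 (P i) ≡ 𝟙 (Q i) + 𝟙 ((P ∖ Q) i)
  split i with Q i in i∈Q | P i in i∈P
  ... | true  | true  = refl
  ... | true  | false = contradiction (trans (sym i∈P) (Q⊆P i i∈Q)) λ ()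
  ... | false | true  = refl
  ... | false | false = refl

∪-split : {Q R : VSet n} → (∀ i → i ∈ Q → i ∈ R → ⊥) → (Q ∪ R) ≐ Q ⊔ R
∪-split {Q = Q} {R} disjoint = mk≐ split
  where
  split : ∀ i → 𝟙 ((Q ∪ R) i) ≡ 𝟙 (Q i) + 𝟙 (R i)
  split i with Q i in i∈Q | R i in i∈R
  ... | true  | true  = ⊥-elim (disjoint i i∈Q i∈R)
  ... | true  | false = refl
  ... | false | _     = refl

sumOver-remove : {c : Fin n} {P : VSet n} → c ∈ P →
  ∀ f → sumOver P f ≡ f c + sumOver (P ∖ ｛ c ｝) f
sumOver-remove {c = c} {P} c∈P f =
  trans (sumOver-split (⊆-split (singleton-⊆ {P = P} c∈P)) f)
        (cong (_+ sumOver (P ∖ ｛ c ｝) f) (sumOver-singleton c f))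

card-remove : {c : Fin n} {P : VSet n} → c ∈ P → card P ≡ suc (card (P ∖ ｛ c ｝))
card-remove {c = c} {P} c∈P = sumOver-remove {c = c} {P} c∈P (λ _ → 1)

pair-split : {y z : Fin n} → ¬ y ≡ z → ｛ y ｝ ∪ ｛ z ｝ ≐ ｛ y ｝ ⊔ ｛ z ｝
pair-split {y = y} {z} y≢z = ∪-split λ i i∈y i∈z →
  y≢z (trans (sym (∈-singleton {i = i} {y} i∈y)) (∈-singleton {i = i} {z} i∈z))

sumOver-pair : {y z : Fin n} → ¬ y ≡ z → ∀ f → sumOver (｛ y ｝ ∪ ｛ z ｝) f ≡ f y + f z
sumOver-pair {y = y} {z} y≢z f =
  trans (sumOver-split (pair-split y≢z) f) (cong₂ _+_ (sumOver-singleton y f) (sumOver-singleton z f))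

card-everything : ∀ n → card {n} everything ≡ n
card-everything zero    = refl
card-everything (suc n) = cong suc (card-everything n)

subset-of-size : ∀ k (P : VSet n) → k ≤ card P → Σ (VSet n) λ Q → Q ⊆ P × card Q ≡ k
subset-of-size {n} zero P _ = (λ _ → false) , (λ _ ()) , sum-replicate-zero n
subset-of-size {suc n} (suc k) P k≤P with P zero in 0∈P
... | false with subset-of-size (suc k) (λ i → P (suc i)) k≤P
...   | Q , Q⊆P , ∣Q∣ = (λ { zero → false ; (suc i) → Q i })
                      , (λ { zero () ; (suc i) → Q⊆P i }) , ∣Q∣
subset-of-size {suc n} (suc k) P (s≤s k≤P) | true with subset-of-size k (λ i → P (suc i)) k≤P
...   | Q , Q⊆P , ∣Q∣ = (λ { zero → true ; (suc i) → Q i })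
                      , (λ { zero _ → 0∈P ; (suc i) → Q⊆P i }) , cong suc ∣Q∣

∣∣-card : (S : Subset n) → ∣ S ∣ ≡ card (lookup S)
∣∣-card []          = refl
∣∣-card (true ∷ S)  = cong suc (∣∣-card S)
∣∣-card (false ∷ S) = ∣∣-card S

𝟙-∧ : ∀ a b → 𝟙 (a ∧ b) ≡ 𝟙 a * 𝟙 b
𝟙-∧ true  b = sym (+-identityʳ (𝟙 b))
𝟙-∧ false b = refl

listSum-allFin : ∀ (f : Fin n → ℕ) → listSum (mapList f (allFin n)) ≡ sum f
listSum-allFin f = trans (cong listSum (map-tabulate (λ i → i) f)) (listSum-tabulate f)
  where
  listSum-tabulate : ∀ {m} (g : Fin m → ℕ) → listSum (tabulate g) ≡ sum g
  listSum-tabulate {zero}  g = refl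
  listSum-tabulate {suc m} g = cong (g zero +_) (listSum-tabulate (λ i → g (suc i)))

<ᵇ-split : ∀ (i j : Fin n) b → (i ≡ j → b ≡ false) →
  𝟙 b ≡ 𝟙 ((toℕ i <ᵇ toℕ j) ∧ b) + 𝟙 ((toℕ j <ᵇ toℕ i) ∧ b)
<ᵇ-split i j b i≡j⇒¬b
  with toℕ i <ᵇ toℕ j | <ᵇ-reflects-< (toℕ i) (toℕ j)
     | toℕ j <ᵇ toℕ i | <ᵇ-reflects-< (toℕ j) (toℕ i)
... | true  | ofʸ i<j | true  | ofʸ j<i = contradiction j<i (<-asym i<j)
... | true  | _       | false | _       = sym (+-identityʳ (𝟙 b))
... | false | _       | true  | _       = refl
... | false | ofⁿ i≮j | false | ofⁿ j≮i
  rewrite i≡j⇒¬b (toℕ-injective (≤-antisym (≮⇒≥ j≮i) (≮⇒≥ i≮j))) = refl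

sum-pairs : (B : Fin n → Fin n → Bool) → (∀ i j → B i j ≡ B j i) → (∀ i → B i i ≡ false) →
  sum (λ i → sum (λ j → 𝟙 (B i j)))
    ≡ 2 * sum (λ i → sum (λ j → 𝟙 ((toℕ i <ᵇ toℕ j) ∧ B i j)))
sum-pairs {n} B B-sym B-irrefl = begin
  sum (λ i → sum (λ j → 𝟙 (B i j)))
    ≡⟨ sum-cong-≗ (λ i → trans (sum-cong-≗ (λ j → <ᵇ-split i j (B i j) (B-irrefl′ i j)))
                               (∑-distrib-+ (λ j → below i j) (λ j → above i j))) ⟩
  sum (λ i → sum (λ j → below i j) + sum (λ j → above i j))
    ≡⟨ ∑-distrib-+ (λ i → sum (λ j → below i j)) (λ i → sum (λ j → above i j)) ⟩
  Below + sum (λ i → sum (λ j → above i j))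
    ≡⟨ cong (Below +_) (trans (∑-comm above) (sum-cong-≗ λ j → sum-cong-≗ λ i →
         cong (λ b → 𝟙 ((toℕ j <ᵇ toℕ i) ∧ b)) (B-sym i j))) ⟩
  Below + Below
    ≡⟨ cong (Below +_) (sym (+-identityʳ Below)) ⟩
  2 * Below ∎
  where
  open ≡-Reasoning
  below above : Fin n → Fin n → ℕ
  below i j = 𝟙 ((toℕ i <ᵇ toℕ j) ∧ B i j)
  above i j = 𝟙 ((toℕ j <ᵇ toℕ i) ∧ B i j)
  Below : ℕ
  Below = sum (λ i → sum (λ j → below i j))
  B-irrefl′ : ∀ i j → i ≡ j → B i j ≡ false
  B-irrefl′ i .i refl = B-irrefl i

-- Counting edges of a fixed graph G between vertex sets.
module _ {n : ℕ} (G : Graph n) where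

  A : Fin n → Fin n → ℕ
  A i j = 𝟙 (adj G i j)

  N : Fin n → VSet n
  N x = adj G x

  degIn : VSet n → Fin n → ℕ
  degIn Q x = sumOver Q (A x)

  deg : Fin n → ℕ
  deg = degIn everything

  -- E P Q counts the ordered pairs (i , j) ∈ P × Q with i ~ j, so an edge
  -- with both ends in P ∩ Q is counted twice.
  E : VSet n → VSet n → ℕ
  E P Q = sumOver P (degIn Q)

  Independent : VSet n → Set
  Independent P = ∀ i j → i ∈ P → j ∈ P → adj G i j ≡ true → ⊥

  degIn-split : {Q Q₁ Q₂ : VSet n} → Q ≐ Q₁ ⊔ Q₂ → ∀ x → degIn Q x ≡ degIn Q₁ x + degIn Q₂ x
  degIn-split s x = sumOver-split s (A x)

  E-splitˡ : {P P₁ P₂ : VSet n} → P ≐ P₁ ⊔ P₂ → ∀ Q → E P Q ≡ E P₁ Q + E P₂ Q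
  E-splitˡ s Q = sumOver-split s (degIn Q)

  E-splitʳ : ∀ P {Q Q₁ Q₂ : VSet n} → Q ≐ Q₁ ⊔ Q₂ → E P Q ≡ E P Q₁ + E P Q₂
  E-splitʳ P {Q} {Q₁} {Q₂} s =
    trans (sumOver-cong P (degIn-split s)) (sumOver-+ P (degIn Q₁) (degIn Q₂))

  degIn-singleton : ∀ z x → degIn ｛ z ｝ x ≡ A x z
  degIn-singleton z x = sumOver-singleton z (A x)

  E-singleton : ∀ y Q → E ｛ y ｝ Q ≡ degIn Q y
  E-singleton y Q = sumOver-singleton y (degIn Q)

  E-double : ∀ P Q → E P Q ≡ sum (λ i → sum (λ j → 𝟙 (P i ∧ (Q j ∧ adj G i j))))
  E-double P Q = sum-cong-≗ λ i → trans (*-distribˡ-sum (𝟙 (P i)) (λ j → 𝟙 (Q j) * A i j))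
    (sum-cong-≗ λ j → sym (trans (𝟙-∧ (P i) _) (cong (𝟙 (P i) *_) (𝟙-∧ (Q j) (adj G i j)))))

  E-sym : ∀ P Q → E P Q ≡ E Q P
  E-sym P Q = begin
    E P Q
      ≡⟨ E-double P Q ⟩
    sum (λ i → sum (λ j → 𝟙 (P i ∧ (Q j ∧ adj G i j))))
      ≡⟨ ∑-comm (λ i j → 𝟙 (P i ∧ (Q j ∧ adj G i j))) ⟩
    sum (λ j → sum (λ i → 𝟙 (P i ∧ (Q j ∧ adj G i j))))
      ≡⟨ sum-cong-≗ (λ j → sum-cong-≗ λ i → cong 𝟙 (swap i j)) ⟩
    sum (λ j → sum (λ i → 𝟙 (Q j ∧ (P i ∧ adj G j i))))
      ≡⟨ sym (E-double Q P) ⟩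
    E Q P ∎
    where
    open ≡-Reasoning
    swap : ∀ i j → P i ∧ (Q j ∧ adj G i j) ≡ Q j ∧ (P i ∧ adj G j i)
    swap i j rewrite Graph.sym G i j with P i | Q j
    ... | true  | _     = refl
    ... | false | true  = refl
    ... | false | false = refl

  E-independent : ∀ {P} → Independent P → E P P ≡ 0
  E-independent {P} indep = trans (E-double P P) (sum-zero λ i → sum-zero λ j → no-edge i j)
    where
    no-edge : ∀ i j → 𝟙 (P i ∧ (P j ∧ adj G i j)) ≡ 0
    no-edge i j with P i in i∈P | P j in j∈P | adj G i j in i~j
    ... | true  | true  | true  = ⊥-elim (indep i j i∈P j∈P i~j)
    ... | true  | true  | false = refl
    ... | true  | false | _     = refl
    ... | false | _     | _     = refl

  independent-⊆ : ∀ {P Q} → Q ⊆ P → Independent P → Independent Q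
  independent-⊆ Q⊆P indep i j i∈Q j∈Q = indep i j (Q⊆P i i∈Q) (Q⊆P j j∈Q)

  adjacent-distinct : ∀ {y z} → adj G y z ≡ true → ¬ y ≡ z
  adjacent-distinct {y} y~z refl = contradiction (trans (sym y~z) (irrefl G y)) λ ()

  adj-sym : ∀ {y z} → adj G y z ≡ true → adj G z y ≡ true
  adj-sym {y} {z} y~z = trans (Graph.sym G z y) y~z

  edge-or-independent : ∀ P → Independent P ⊎ ∃₂ λ i j → i ∈ P × j ∈ P × adj G i j ≡ true
  edge-or-independent P with any? (λ i → any? (λ j → (P i ∧ (P j ∧ adj G i j)) ≟ᵇ true))
  ... | no  no-edge = inj₁ λ i j i∈P j∈P i~j → no-edge (i , j , ∧-intro i∈P (∧-intro j∈P i~j))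
  ... | yes (i , j , edge) with ∧-true {P i} edge
  ...   | i∈P , rest with ∧-true {P j} rest
  ...     | j∈P , i~j = inj₂ (i , j , i∈P , j∈P , i~j)

  degIn-card : ∀ Q x → degIn Q x ≡ card (Q ∩ N x)
  degIn-card Q x = sum-cong-≗ λ j → sym (trans (*-identityʳ _) (𝟙-∧ (Q j) (adj G x j)))

  E-cong : ∀ {P P′ Q Q′} → (∀ i → P i ≡ P′ i) → (∀ i → Q i ≡ Q′ i) → E P Q ≡ E P′ Q′
  E-cong P≗P′ Q≗Q′ = sum-cong-≗ λ i →
    cong₂ (λ b d → 𝟙 b * d) (P≗P′ i) (sum-cong-≗ λ j → cong (λ b → 𝟙 b * A i j) (Q≗Q′ j))

  twice-edgesIn : ∀ S → 2 * edgesIn G S ≡ E (lookup S) (lookup S)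
  twice-edgesIn S = begin
    2 * edgesIn G S
      ≡⟨ cong (2 *_) (trans (listSum-allFin (λ i → listSum (mapList (pair i) (allFin n))))
           (sum-cong-≗ λ i → trans (listSum-allFin (pair i)) (sum-cong-≗ λ j → if-𝟙 (ordered i j)))) ⟩
    2 * sum (λ i → sum (λ j → 𝟙 ((toℕ i <ᵇ toℕ j) ∧ B i j)))
      ≡⟨ sym (sum-pairs B B-sym B-irrefl) ⟩
    sum (λ i → sum (λ j → 𝟙 (B i j)))
      ≡⟨ sym (E-double (lookup S) (lookup S)) ⟩
    E (lookup S) (lookup S) ∎
    where
    open ≡-Reasoning
    B ordered : Fin n → Fin n → Bool
    B i j = lookup S i ∧ (lookup S j ∧ adj G i j)
    ordered i j = (toℕ i <ᵇ toℕ j) ∧ B i j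
    pair : Fin n → Fin n → ℕ
    pair i j = if ordered i j then 1 else 0
    if-𝟙 : ∀ b → (if b then 1 else 0) ≡ 𝟙 b
    if-𝟙 true  = refl
    if-𝟙 false = refl
    B-sym : ∀ i j → B i j ≡ B j i
    B-sym i j rewrite Graph.sym G i j with lookup S i | lookup S j
    ... | true  | _     = refl
    ... | false | true  = refl
    ... | false | false = refl
    B-irrefl : ∀ i → B i i ≡ false
    B-irrefl i rewrite irrefl G i = trans (cong (lookup S i ∧_) (∧-zeroʳ (lookup S i))) (∧-zeroʳ (lookup S i))

  handshake : 2 * e G ≡ E everything everything
  handshake = trans (twice-edgesIn ⊤) (E-cong (λ i → lookup-replicate i true) (λ i → lookup-replicate i true))

  -- If the vertex set splits as I ⊔ T ⊔ R with I and T
  -- independent, every edge joins T to I or has an end in R, so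
  -- e(G) ≤ E T I + ∑_{x ∈ R} deg x.  (Edges inside R are counted twice on
  -- the right, which is where the inequality comes from.)
  cover : ∀ {I U T R} → everything ≐ I ⊔ U → U ≐ T ⊔ R → Independent I → Independent T →
    e G ≤ E T I + E R everything
  cover {I} {U} {T} {R} sV sU indI indT = *-cancelˡ-≤ 2 (begin
    2 * e G                                  ≤⟨ m≤m+n (2 * e G) d ⟩
    2 * e G + d                              ≡⟨ cong (_+ d) (trans handshake edge-count) ⟩
    (a + b) + ((a + c) + X) + d              ≡⟨ cong (λ x → (a + b) + ((a + c) + x) + d) X≡ ⟩
    (a + b) + ((a + c) + (b + (c + d))) + d  ≡⟨ regroup a b c d ⟩
    2 * (a + (b + (c + d)))                  ≡⟨ cong (λ x → 2 * (a + x)) (sym X≡) ⟩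
    2 * (a + X)                              ∎)
    where
    open ≤-Reasoning
    V : VSet n
    V = everything
    a b c d X : ℕ
    a = E T I
    b = E R I
    c = E R T
    d = E R R
    X = E R V
    X≡ : X ≡ b + (c + d)
    X≡ = trans (E-splitʳ R sV) (cong (b +_) (E-splitʳ R sU))
    edge-count : E V V ≡ (a + b) + ((a + c) + X)
    edge-count = trans (E-splitˡ sV V) (cong₂ _+_
      (trans (E-splitʳ I sV) (cong₂ _+_ (E-independent indI)
        (trans (E-splitʳ I sU) (cong₂ _+_ (E-sym I T) (E-sym I R)))))
      (trans (E-splitˡ sU V) (cong (_+ X)
        (trans (E-splitʳ T sV) (cong (a +_)
          (trans (E-splitʳ T sU) (cong₂ _+_ (E-independent indT) (E-sym T R))))))))
    regroup : ∀ a b c d → (a + b) + ((a + c) + (b + (c + d))) + d ≡ 2 * (a + (b + (c + d)))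
    regroup = solve-∀

  cover-identity : ∀ {C P} → C ⊆ P → Independent (P ∖ C) → E P P + E C C ≡ 2 * E C P
  cover-identity {C} {P} C⊆P indD = begin
    E P P + E C C                    ≡⟨ cong (_+ E C C) (E-splitˡ s P) ⟩
    E C P + E D P + E C C            ≡⟨ cong (λ x → E C P + x + E C C) D-row ⟩
    E C P + (E C D + 0) + E C C      ≡⟨ regroup (E C P) (E C C) (E C D) ⟩
    E C P + (E C C + E C D)          ≡⟨ cong (E C P +_) (sym (E-splitʳ C s)) ⟩
    E C P + E C P                    ≡⟨ cong (E C P +_) (sym (+-identityʳ (E C P))) ⟩
    2 * E C P                        ∎
    where
    open ≡-Reasoning
    D : VSet n
    D = P ∖ C
    s : P ≐ C ⊔ D
    s = ⊆-split C⊆P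
    D-row : E D P ≡ E C D + 0
    D-row = trans (E-splitʳ D s) (cong₂ _+_ (E-sym D C) (E-independent indD))
    regroup : ∀ p x y → p + (y + 0) + x ≡ p + (x + y)
    regroup = solve-∀

  module _ (triangle-free : TriangleFree G) where

    neighbourhood-independent : ∀ x → Independent (N x)
    neighbourhood-independent x i j x~i x~j i~j = triangle-free x i j (x~i , i~j , x~j)

    adjacent-degIn : ∀ {y z} → adj G y z ≡ true → ∀ Q → degIn Q y + degIn Q z ≤ card Q
    adjacent-degIn {y} {z} y~z Q =
      ≤-trans (≤-reflexive (sym (sumOver-+ Q (A y) (A z)))) (sumOver-mono at-most-one)
      where
      at-most-one : ∀ i → i ∈ Q → A y i + A z i ≤ 1
      at-most-one i _ with adj G y i in y~i | adj G z i in z~i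
      ... | true  | true  = ⊥-elim (triangle-free y z i (y~z , z~i , y~i))
      ... | true  | false = ≤-refl
      ... | false | true  = ≤-refl
      ... | false | false = z≤n

-- (A − 1)(D − 1) ≥ t² for A, D > t, rearranged to avoid subtraction.
product-bound : ∀ t A D → t < A → t < D → A + D + t * t ≤ D * A + 1
product-bound t (suc A) (suc D) (s≤s t≤A) (s≤s t≤D) =
  ≤-trans (+-monoʳ-≤ (suc A + suc D) (*-mono-≤ t≤D t≤A)) (≤-reflexive (expand A D))
  where
  expand : ∀ A D → suc A + suc D + D * A ≡ suc D * suc A + 1
  expand = solve-∀

linear-room : ∀ {t K} → 2 ≤ t → 2 * (t * t) < K → 2 * t + 3 ≤ K
linear-room {suc zero} (s≤s ()) _
linear-room {suc (suc s)} {K} _ 2t²<K =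
  ≤-trans (≤-trans (m≤m+n _ (2 * (s * s) + 6 * s + 2)) (≤-reflexive (expand s))) 2t²<K
  where
  expand : ∀ s → 2 * suc (suc s) + 3 + (2 * (s * s) + 6 * s + 2) ≡ suc (2 * (suc (suc s) * suc (suc s)))
  expand = solve-∀

-- Numerical core of the case without a vertex of degree K.
low-degree-arith : ∀ {e t K} → 2 * e ≤ (K + suc K) * pred K → 2 * (t * t) < K →
  e + t * t ≤ K * K + 1
low-degree-arith {K = zero} _ ()
low-degree-arith {e} {t} {suc K} 2e≤ 2t²<K = *-cancelˡ-≤ 2 (begin
  2 * (e + t * t)                       ≡⟨ *-distribˡ-+ 2 e (t * t) ⟩
  2 * e + 2 * (t * t)                   ≤⟨ +-mono-≤ 2e≤ (≤-pred 2t²<K) ⟩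
  (suc K + suc (suc K)) * K + K         ≤⟨ m≤m+n _ 4 ⟩
  (suc K + suc (suc K)) * K + K + 4     ≡⟨ expand K ⟩
  2 * (suc K * suc K + 1)               ∎)
  where
  open ≤-Reasoning
  expand : ∀ K → (suc K + suc (suc K)) * K + K + 4 ≡ 2 * (suc K * suc K + 1)
  expand = solve-∀

-- Numerical core of case A.
caseA-arith : ∀ {e X Y A D r t K} → e ≤ X + ((A + D) + Y) → X + D * A ≤ D * K → Y ≤ r * K →
  K ≡ D + r → t < A → t < D → e + t * t ≤ K * K + 1
caseA-arith {e} {X} {Y} {A} {D} {r} {t} {K} e≤ X≤ Y≤ K≡D+r t<A t<D = +-cancelʳ-≤ (D * A) _ _ (begin
  e + t * t + D * A                    ≤⟨ +-monoˡ-≤ (D * A) (+-monoˡ-≤ (t * t) e≤) ⟩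
  X + ((A + D) + Y) + t * t + D * A    ≡⟨ regroup X A D Y (t * t) (D * A) ⟩
  (X + D * A) + Y + (A + D + t * t)    ≤⟨ +-mono-≤ (+-mono-≤ X≤ Y≤) (product-bound t A D t<A t<D) ⟩
  D * K + r * K + (D * A + 1)          ≡⟨ collect D r K (D * A) ⟩
  (D + r) * K + 1 + D * A              ≡⟨ cong (λ m → m * K + 1 + D * A) (sym K≡D+r) ⟩
  K * K + 1 + D * A                    ∎)
  where
  open ≤-Reasoning
  regroup : ∀ X A D Y T W → X + ((A + D) + Y) + T + W ≡ (X + W) + Y + (A + D + T)
  regroup = solve-∀
  collect : ∀ D r K W → D * K + r * K + (W + 1) ≡ (D + r) * K + 1 + W
  collect = solve-∀

-- Numerical core of case B.
caseB-arith : ∀ {e ay aq az dz aq′ dq′ Y r t K} →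
  e ≤ (ay + aq) + ((az + dz) + ((aq′ + dq′) + Y)) → ay + az ≤ K → aq + aq′ ≤ K →
  dz ≤ t → dq′ ≤ t → Y ≤ r * K → K ≡ 3 + r → 2 * (t * t) < K → e + t * t ≤ K * K + 1
caseB-arith {e} {ay} {aq} {az} {dz} {aq′} {dq′} {Y} {r} {t} {K}
  e≤ yz≤ qq′≤ dz≤ dq′≤ Y≤ K≡3+r 2t²<K = begin
  e + t * t                                          ≤⟨ +-monoˡ-≤ (t * t) e≤ ⟩
  (ay + aq) + ((az + dz) + ((aq′ + dq′) + Y)) + t * t  ≡⟨ regroup ay aq az dz aq′ dq′ Y (t * t) ⟩
  (ay + az) + (aq + aq′) + ((dz + dq′) + Y) + t * t    ≤⟨ +-monoˡ-≤ (t * t)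
                                                          (+-mono-≤ (+-mono-≤ yz≤ qq′≤) (+-mono-≤ (+-mono-≤ dz≤ dq′≤) Y≤)) ⟩
  K + K + ((t + t) + r * K) + t * t                  ≡⟨ regroup′ K t (r * K) ⟩
  K + K + r * K + (2 * t + t * t)                    ≤⟨ +-monoʳ-≤ (K + K + r * K) quadratic ⟩
  K + K + r * K + (K + 1)                            ≡⟨ collect K r ⟩
  (3 + r) * K + 1                                    ≡⟨ cong (λ m → m * K + 1) (sym K≡3+r) ⟩
  K * K + 1                                          ∎
  where
  open ≤-Reasoning
  regroup : ∀ ay aq az dz aq′ dq′ Y T →
    (ay + aq) + ((az + dz) + ((aq′ + dq′) + Y)) + T ≡ (ay + az) + (aq + aq′) + ((dz + dq′) + Y) + T
  regroup = solve-∀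
  regroup′ : ∀ K t W → K + K + ((t + t) + W) + t * t ≡ K + K + W + (2 * t + t * t)
  regroup′ = solve-∀
  collect : ∀ K r → K + K + r * K + (K + 1) ≡ (3 + r) * K + 1
  collect = solve-∀
  -- 2t + t² ≤ 2t² + 2 < K + 2, since (t − 1)² ≥ 0.
  square-gap : ∀ t → 2 * t ≤ t * t + 1
  square-gap zero = z≤n
  square-gap (suc s) = ≤-trans (m≤m+n (2 * suc s) (s * s)) (≤-reflexive (expand s))
    where
    expand : ∀ s → 2 * suc s + s * s ≡ suc s * suc s + 1
    expand = solve-∀
  quadratic : 2 * t + t * t ≤ K + 1
  quadratic = ≤-trans (+-monoˡ-≤ (t * t) (square-gap t))
    (≤-trans (≤-reflexive (expand t)) (≤-trans 2t²<K (m≤m+n K 1)))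
    where
    expand : ∀ t → t * t + 1 + t * t ≡ suc (2 * (t * t))
    expand = solve-∀

caseC-collect : ∀ {e XP XQ ay az p q Y r K} →
  e ≤ (XP + XQ) + ((ay + suc p) + ((az + suc q) + Y)) →
  XP + p * ay ≤ p * K → XQ + q * az ≤ q * K → Y ≤ r * K →
  e + (p * ay + q * az) ≤ (p + q + r) * K + (ay + az) + (p + q + 2)
caseC-collect {e} {XP} {XQ} {ay} {az} {p} {q} {Y} {r} {K} e≤ XP≤ XQ≤ Y≤ = begin
  e + (p * ay + q * az)
    ≤⟨ +-monoˡ-≤ (p * ay + q * az) e≤ ⟩
  (XP + XQ) + ((ay + suc p) + ((az + suc q) + Y)) + (p * ay + q * az)
    ≡⟨ regroup XP XQ ay az p q Y (p * ay) (q * az) ⟩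
  (XP + p * ay) + (XQ + q * az) + Y + (ay + az) + (p + q + 2)
    ≤⟨ +-monoˡ-≤ (p + q + 2) (+-monoˡ-≤ (ay + az) (+-mono-≤ (+-mono-≤ XP≤ XQ≤) Y≤)) ⟩
  p * K + q * K + r * K + (ay + az) + (p + q + 2)
    ≡⟨ collect p q r K (ay + az) (p + q + 2) ⟩
  (p + q + r) * K + (ay + az) + (p + q + 2) ∎
  where
  open ≤-Reasoning
  regroup : ∀ XP XQ ay az p q Y u w →
    (XP + XQ) + ((ay + suc p) + ((az + suc q) + Y)) + (u + w)
      ≡ (XP + u) + (XQ + w) + Y + (ay + az) + (p + q + 2)
  regroup = solve-∀
  collect : ∀ p q r K u w → p * K + q * K + r * K + u + w ≡ (p + q + r) * K + u + w
  collect = solve-∀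

-- Numerical core of case C.  Here p and q are the numbers of neighbours
-- of y, resp. z, inside J other than z, resp. y; both are positive since
-- t ≤ p + q while p, q < t.
caseC-arith : ∀ {e XP XQ ay az p q Y r t K} →
  e ≤ (XP + XQ) + ((ay + suc p) + ((az + suc q) + Y)) →
  XP + p * ay ≤ p * K → XQ + q * az ≤ q * K → t < ay → t < az → Y ≤ r * K →
  K ≡ suc (p + q + r) → t ≤ p + q → p < t → q < t → 2 * (t * t) < K → e + t * t ≤ K * K + 1
caseC-arith {p = zero} {q} _ _ _ _ _ _ _ t≤q _ q<t _ = contradiction q<t (≤⇒≯ t≤q)
caseC-arith {p = suc p} {zero} {t = t} _ _ _ _ _ _ _ t≤p p<t _ _ =
  contradiction p<t (≤⇒≯ (subst (t ≤_) (+-identityʳ (suc p)) t≤p))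
caseC-arith {e} {XP} {XQ} {ay} {az} {suc p} {suc q} {Y} {r} {t} {K}
  e≤ XP≤ XQ≤ t<ay t<az Y≤ K≡ t≤p+q p<t _ 2t²<K = +-cancelʳ-≤ (p + q) _ _ (begin
    e + t * t + (p + q)                  ≤⟨ +-monoˡ-≤ (p + q) (+-monoʳ-≤ e square≤) ⟩
    e + ((p + q) * t + 2 * t) + (p + q)  ≡⟨ regroup e (p + q) t ⟩
    e + ((p + q) * suc t) + 2 * t        ≤⟨ +-monoˡ-≤ (2 * t) (+-monoʳ-≤ e weights≥) ⟩
    e + W + 2 * t                        ≤⟨ +-monoˡ-≤ (2 * t) e+W≤ ⟩
    L * K + (suc p + suc q + 2) + 2 * t  ≡⟨ regroup′ (L * K) p q t ⟩
    L * K + (2 * t + 3) + suc (p + q)    ≤⟨ +-monoˡ-≤ (suc (p + q)) (+-monoʳ-≤ (L * K) (linear-room 2≤t 2t²<K)) ⟩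
    L * K + K + suc (p + q)              ≡⟨ cong (λ m → m + suc (p + q)) (trans (+-comm (L * K) K) (cong (_* K) (sym K≡))) ⟩
    K * K + suc (p + q)                  ≡⟨ +-assoc (K * K) 1 (p + q) ⟨
    K * K + 1 + (p + q)                  ∎)
  where
  open ≤-Reasoning
  L W : ℕ
  L = suc p + suc q + r
  W = p * ay + q * az
  2≤t : 2 ≤ t
  2≤t = ≤-trans (s≤s (s≤s z≤n)) p<t
  square≤ : t * t ≤ (p + q) * t + 2 * t
  square≤ = ≤-trans (*-monoˡ-≤ t t≤p+q) (≤-reflexive (expand p q t))
    where
    expand : ∀ p q t → (suc p + suc q) * t ≡ (p + q) * t + 2 * t
    expand = solve-∀
  -- ay, az ≥ t + 1
  weights≥ : (p + q) * suc t ≤ W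
  weights≥ = ≤-trans (≤-reflexive (*-distribʳ-+ (suc t) p q)) (+-mono-≤ (*-monoʳ-≤ p t<ay) (*-monoʳ-≤ q t<az))
  e+W≤ : e + W ≤ L * K + (suc p + suc q + 2)
  e+W≤ = +-cancelʳ-≤ (ay + az) _ _ (≤-trans (≤-reflexive (expand e ay az p q))
    (≤-trans (caseC-collect {e} {XP} {XQ} {ay} {az} {suc p} {suc q} {Y} {r} {K} e≤ XP≤ XQ≤ Y≤)
             (≤-reflexive (+-comm-last (L * K) (ay + az) (suc p + suc q + 2)))))
    where
    expand : ∀ e ay az p q → e + (p * ay + q * az) + (ay + az) ≡ e + (suc p * ay + suc q * az)
    expand = solve-∀
    +-comm-last : ∀ x u w → x + u + w ≡ x + w + u
    +-comm-last = solve-∀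
  regroup : ∀ e s t → e + (s * t + 2 * t) + s ≡ e + s * suc t + 2 * t
  regroup = solve-∀
  regroup′ : ∀ M p q t → M + (suc p + suc q + 2) + 2 * t ≡ M + (2 * t + 3) + suc (p + q)
  regroup′ = solve-∀

module Dense {n : ℕ} (G : Graph n) (triangle-free : TriangleFree G) (K t : ℕ)
  (n≡2K+1 : n ≡ K + suc K)
  (dense : ∀ (S : Subset n) → ∣ S ∣ ≡ suc K → t + 1 ≤ edgesIn G S) where

  dense-E : ∀ P → card P ≡ suc K → 2 * (t + 1) ≤ E G P P
  dense-E P ∣P∣ = ≤-trans (*-monoʳ-≤ 2 (dense S ∣S∣))
    (≤-reflexive (trans (twice-edgesIn G S) (E-cong G (lookup∘tabulate P) (lookup∘tabulate P))))
    where
    S : Subset n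
    S = tabulateᵛ P
    ∣S∣ : ∣ S ∣ ≡ suc K
    ∣S∣ = trans (∣∣-card S) (trans (sum-cong-≗ λ i → cong (λ b → 𝟙 b * 1) (lookup∘tabulate P i)) ∣P∣)

  dense-not-independent : ∀ {P} → card P ≡ suc K → ¬ Independent G P
  dense-not-independent {P} ∣P∣ indep = 1≰0 (begin
    1                ≤⟨ m≤n+m 1 t ⟩
    t + 1            ≤⟨ m≤m+n (t + 1) (t + 1 + 0) ⟩
    2 * (t + 1)      ≤⟨ dense-E P ∣P∣ ⟩
    E G P P          ≡⟨ E-independent G indep ⟩
    0                ∎)
    where
    open ≤-Reasoning
    1≰0 : ¬ 1 ≤ 0
    1≰0 ()

  independent-small : ∀ {P} → Independent G P → card P ≤ K
  independent-small {P} indep with suc K ≤? card P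
  ... | no  K<P̸ = ≤-pred (≰⇒> K<P̸)
  ... | yes K<P with subset-of-size (suc K) P K<P
  ...   | Q , Q⊆P , ∣Q∣ = contradiction (independent-⊆ G Q⊆P indep) (dense-not-independent ∣Q∣)

  deg≤K : ∀ x → deg G x ≤ K
  deg≤K x = subst (_≤ K) (sym (degIn-card G everything x))
    (independent-small (neighbourhood-independent G triangle-free x))

  low-degree : 2 * (t * t) < K → (∀ x → deg G x < K) → e G + t * t ≤ K * K + 1
  low-degree 2t²<K deg<K = low-degree-arith {e G} {t} {K} (begin
    2 * e G                     ≡⟨ handshake G ⟩
    E G everything everything   ≤⟨ sumOver-bound everything (pred K) (λ x _ → <⇒≤pred (deg<K x)) ⟩
    card {n} everything * pred K ≡⟨ cong (_* pred K) (trans (card-everything n) n≡2K+1) ⟩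
    (K + suc K) * pred K        ∎) 2t²<K
    where open ≤-Reasoning

  module MaxDegree (v : Fin n) (deg-v : deg G v ≡ K) where

    I J : VSet n
    I = N G v
    J = everything ∖ I

    V-split : everything ≐ I ⊔ J
    V-split = ⊆-split (λ _ _ → refl)

    I-independent : Independent G I
    I-independent = neighbourhood-independent G triangle-free v

    card-I : card I ≡ K
    card-I = trans (sym (degIn-card G everything v)) deg-v

    card-J : card J ≡ suc K
    card-J = +-cancelˡ-≡ K _ _ (begin
      K + card J        ≡⟨ cong (_+ card J) card-I ⟨
      card I + card J   ≡⟨ sumOver-split V-split (λ _ → 1) ⟨
      card {n} everything ≡⟨ card-everything n ⟩
      n                 ≡⟨ n≡2K+1 ⟩
      K + suc K         ∎)
      where open ≡-Reasoning

    a d : Fin n → ℕ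
    a = degIn G I
    d = degIn G J

    deg-split : ∀ y → deg G y ≡ a y + d y
    deg-split = degIn-split G V-split

    a-adjacent : ∀ {y z} → adj G y z ≡ true → a y + a z ≤ K
    a-adjacent {y} {z} y~z = subst (a y + a z ≤_) card-I (adjacent-degIn G triangle-free y~z I)

    -- Every y ∈ J has more than t neighbours in I: the K + 1 vertices of
    -- I ∪ {y} span only the a y edges at y.
    a-large : ∀ {y} → y ∈ J → t < a y
    a-large {y} y∈J =
      subst (_≤ a y) (+-comm t 1) (*-cancelˡ-≤ 2 (≤-trans (dense-E P card-P) (≤-reflexive E-PP)))
      where
      C P : VSet n
      C = ｛ y ｝
      P = I ∪ C
      P-split : P ≐ I ⊔ C
      P-split = ∪-split λ i i∈I i∈C →
        proj₂ (∈-∖⁻ {P = everything} {I} y∈J) (subst (_∈ I) (∈-singleton {i = i} {y} i∈C) i∈I)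
      card-P : card P ≡ suc K
      card-P = trans (sumOver-split P-split (λ _ → 1))
        (trans (cong₂ _+_ card-I (sumOver-singleton y (λ _ → 1))) (+-comm K 1))
      no-loop : degIn G C y ≡ 0
      no-loop = trans (degIn-singleton G y y) (cong 𝟙 (irrefl G y))
      E-PP : E G P P ≡ 2 * a y
      E-PP = begin
        E G P P             ≡⟨ +-identityʳ (E G P P) ⟨
        E G P P + 0         ≡⟨ cong (E G P P +_) (trans (E-singleton G y C) no-loop) ⟨
        E G P P + E G C C   ≡⟨ cover-identity G (∪-⊆ʳ {P = I} {C})
                                 (independent-⊆ G (∪-∖-⊆ {P = I} {C}) I-independent) ⟩
        2 * E G C P         ≡⟨ cong (2 *_) (trans (E-singleton G y P)
                                 (trans (degIn-split G P-split y) (cong (a y +_) no-loop))) ⟩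
        2 * (a y + 0)       ≡⟨ cong (2 *_) (+-identityʳ (a y)) ⟩
        2 * a y             ∎
        where open ≡-Reasoning

    cover-J : ∀ {T} → T ⊆ J → Independent G T → e G ≤ sumOver T a + sumOver (J ∖ T) (deg G)
    cover-J T⊆J T-independent = cover G V-split (⊆-split T⊆J) I-independent T-independent

    card-J-split : ∀ {T} → T ⊆ J → suc K ≡ card T + card (J ∖ T)
    card-J-split T⊆J = trans (sym card-J) (sumOver-split (⊆-split T⊆J) (λ _ → 1))

    deg-bound : ∀ R → sumOver R (deg G) ≤ card R * K
    deg-bound R = sumOver-bound R K (λ i _ → deg≤K i)

    -- Case A: some c ∈ J has more than t neighbours in J.  Cover with the
    -- J-neighbourhood T of c; the vertices of T see at most K − a c
    -- vertices of I each.
    caseA : ∀ {c} → c ∈ J → t < d c → e G + t * t ≤ K * K + 1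
    caseA {c} c∈J t<dc =
      caseA-arith {e G} {sumOver T a} {sumOver R (deg G)} {a c} {d c} {card R} {t} {K}
        e≤ T-bound (deg-bound R) K≡ (a-large c∈J) t<dc
      where
      T R : VSet n
      T = J ∩ N G c
      R = (J ∖ T) ∖ ｛ c ｝
      T⊆J : T ⊆ J
      T⊆J = ∩-⊆ˡ {P = J} {N G c}
      c∈J∖T : c ∈ J ∖ T
      c∈J∖T = ∈-∖ {P = J} {T} c∈J λ c∈T →
        contradiction (trans (sym (proj₂ (∈-∩⁻ {P = J} {N G c} c∈T))) (irrefl G c)) λ ()
      card-T : card T ≡ d c
      card-T = sym (degIn-card G J c)
      e≤ : e G ≤ sumOver T a + ((a c + d c) + sumOver R (deg G))
      e≤ = ≤-trans (cover-J T⊆J (independent-⊆ G (∩-⊆ʳ {P = J} {N G c}) (neighbourhood-independent G triangle-free c)))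
        (≤-reflexive (cong (sumOver T a +_) (trans (sumOver-remove {P = J ∖ T} c∈J∖T (deg G))
          (cong (_+ sumOver R (deg G)) (deg-split c)))))
      T-bound : sumOver T a + d c * a c ≤ d c * K
      T-bound = subst (λ m → sumOver T a + m * a c ≤ m * K) card-T
        (sumOver-bound+ T (a c) K λ i i∈T →
          subst (_≤ K) (+-comm (a c) (a i)) (a-adjacent (proj₂ (∈-∩⁻ {P = J} {N G c} i∈T))))
      K≡ : K ≡ d c + card R
      K≡ = suc-injective (begin
        suc K                    ≡⟨ card-J-split T⊆J ⟩
        card T + card (J ∖ T)    ≡⟨ cong₂ _+_ card-T (card-remove {P = J ∖ T} c∈J∖T) ⟩
        d c + suc (card R)       ≡⟨ +-suc (d c) (card R) ⟩
        suc (d c + card R)       ∎)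
        where open ≡-Reasoning

    -- Case B: J contains disjoint edges yz and qq′ with y ≁ q.  Cover with
    -- the independent pair T = {y, q}.
    caseB : ∀ {y z q q′} → y ∈ J → z ∈ J → q ∈ J → q′ ∈ J →
      adj G y z ≡ true → adj G q q′ ≡ true → adj G y q ≡ false →
      ¬ q ∈ ｛ y ｝ ∪ ｛ z ｝ → ¬ q′ ∈ ｛ y ｝ ∪ ｛ z ｝ →
      (∀ {c} → c ∈ J → d c ≤ t) → 2 * (t * t) < K → e G + t * t ≤ K * K + 1
    caseB {y} {z} {q} {q′} y∈J z∈J q∈J q′∈J y~z q~q′ y≁q q∉yz q′∉yz d≤t 2t²<K =
      caseB-arith {e G} {a y} {a q} {a z} {d z} {a q′} {d q′} {sumOver R (deg G)} {card R} {t} {K}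
        e≤ (a-adjacent y~z) (a-adjacent q~q′) (d≤t z∈J) (d≤t q′∈J) (deg-bound R) K≡ 2t²<K
      where
      T R₁ R : VSet n
      T = ｛ y ｝ ∪ ｛ q ｝
      R₁ = (J ∖ T) ∖ ｛ z ｝
      R = R₁ ∖ ｛ q′ ｝
      y≢q : ¬ y ≡ q
      y≢q y≡q = proj₁ (∉-pair⁻ q∉yz) (sym y≡q)
      T-independent : Independent G T
      T-independent i j i∈T j∈T i~j with ∈-pair⁻ {i = i} {y} {q} i∈T | ∈-pair⁻ {i = j} {y} {q} j∈T
      ... | inj₁ refl | inj₁ refl = adjacent-distinct G i~j refl
      ... | inj₂ refl | inj₂ refl = adjacent-distinct G i~j refl
      ... | inj₁ refl | inj₂ refl = contradiction (trans (sym i~j) y≁q) λ ()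
      ... | inj₂ refl | inj₁ refl = contradiction (trans (sym (adj-sym G i~j)) y≁q) λ ()
      T⊆J : T ⊆ J
      T⊆J = pair-⊆ y∈J q∈J
      z∈J∖T : z ∈ J ∖ T
      z∈J∖T = ∈-∖ {P = J} {T} z∈J (∉-pair (λ z≡y → adjacent-distinct G y~z (sym z≡y))
                                         (λ z≡q → proj₂ (∉-pair⁻ q∉yz) (sym z≡q)))
      q′∈R₁ : q′ ∈ R₁
      q′∈R₁ = ∈-∖-singleton {P = J ∖ T}
        (∈-∖ {P = J} {T} q′∈J
          (∉-pair (proj₁ (∉-pair⁻ q′∉yz)) (λ q′≡q → adjacent-distinct G q~q′ (sym q′≡q))))
        (proj₂ (∉-pair⁻ q′∉yz))
      e≤ : e G ≤ (a y + a q) + ((a z + d z) + ((a q′ + d q′) + sumOver R (deg G)))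
      e≤ = ≤-trans (cover-J T⊆J T-independent) (≤-reflexive (cong₂ _+_ (sumOver-pair y≢q a)
        (trans (sumOver-remove {P = J ∖ T} z∈J∖T (deg G)) (cong₂ _+_ (deg-split z)
          (trans (sumOver-remove {P = R₁} q′∈R₁ (deg G)) (cong (_+ sumOver R (deg G)) (deg-split q′)))))))
      K≡ : K ≡ 3 + card R
      K≡ = suc-injective (trans (card-J-split T⊆J) (cong₂ _+_ (sumOver-pair y≢q (λ _ → 1))
        (trans (card-remove {P = J ∖ T} z∈J∖T) (cong suc (card-remove {P = R₁} q′∈R₁)))))

    -- Case C: J has an edge yz meeting all edges of J.  Cover with the
    -- other J-neighbours P′ of y and Q′ of z, p and q in number.  Then
    -- d y = p + 1 and d z = q + 1, and counting the edges of J, all of which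
    -- meet {y, z}, gives t ≤ p + q.
    module CaseC {y z} (y∈J : y ∈ J) (z∈J : z ∈ J) (y~z : adj G y z ≡ true)
                 (rest-independent : Independent G (J ∖ (｛ y ｝ ∪ ｛ z ｝))) where

      y≢z : ¬ y ≡ z
      y≢z = adjacent-distinct G y~z

      C : VSet n
      C = ｛ y ｝ ∪ ｛ z ｝

      others : Fin n → Fin n → VSet n
      others u w = (J ∩ N G u) ∖ ｛ w ｝

      others⁻ : ∀ {u w i} → i ∈ others u w → i ∈ J × adj G u i ≡ true × ¬ i ≡ w
      others⁻ {u} {w} {i} i∈ with ∈-∖-singleton⁻ {i = i} {w} {J ∩ N G u} i∈
      ... | i∈JNu , i≢w = proj₁ (∈-∩⁻ {P = J} {N G u} i∈JNu) , proj₂ (∈-∩⁻ {P = J} {N G u} i∈JNu) , i≢w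

      d-others : ∀ {u w} → adj G u w ≡ true → w ∈ J → d u ≡ suc (card (others u w))
      d-others {u} u~w w∈J = trans (degIn-card G J u) (card-remove {P = J ∩ N G u} (∧-intro w∈J u~w))

      -- As in case A, the J-neighbours of u see at most K − a u vertices of I.
      others-bound : ∀ u w → sumOver (others u w) a + card (others u w) * a u ≤ card (others u w) * K
      others-bound u w = sumOver-bound+ (others u w) (a u) K λ i i∈ →
        subst (_≤ K) (+-comm (a u) (a i)) (a-adjacent (proj₁ (proj₂ (others⁻ {u} {w} i∈))))

      P′ Q′ T R : VSet n
      P′ = others y z
      Q′ = others z y
      T = P′ ∪ Q′
      R = ((J ∖ T) ∖ ｛ y ｝) ∖ ｛ z ｝

      p q : ℕ
      p = card P′
      q = card Q′

      d-y : d y ≡ suc p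
      d-y = d-others y~z z∈J
      d-z : d z ≡ suc q
      d-z = d-others (adj-sym G y~z) y∈J

      P′-outside : ∀ {i} → i ∈ P′ → i ∈ J ∖ C
      P′-outside i∈ with others⁻ {y} {z} i∈
      ... | i∈J , y~i , i≢z = ∈-∖ {P = J} {C} i∈J (∉-pair (λ i≡y → adjacent-distinct G y~i (sym i≡y)) i≢z)
      Q′-outside : ∀ {i} → i ∈ Q′ → i ∈ J ∖ C
      Q′-outside i∈ with others⁻ {z} {y} i∈
      ... | i∈J , z~i , i≢y = ∈-∖ {P = J} {C} i∈J (∉-pair i≢y (λ i≡z → adjacent-distinct G z~i (sym i≡z)))

      -- P′ and Q′ are disjoint (no triangle on yz) and T = P′ ∪ Q′ is
      -- independent: inside P′ or Q′ by triangle-freeness, between them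
      -- because the edge would avoid {y, z}.
      T-split : T ≐ P′ ⊔ Q′
      T-split = ∪-split λ i i∈P′ i∈Q′ →
        triangle-free y z i (y~z , proj₁ (proj₂ (others⁻ {z} {y} i∈Q′)) , proj₁ (proj₂ (others⁻ {y} {z} i∈P′)))

      T⊆J : T ⊆ J
      T⊆J i i∈T with ∈-∪⁻ {i = i} {P′} {Q′} i∈T
      ... | inj₁ i∈P′ = proj₁ (others⁻ {y} {z} i∈P′)
      ... | inj₂ i∈Q′ = proj₁ (others⁻ {z} {y} i∈Q′)

      T-independent : Independent G T
      T-independent i j i∈T j∈T i~j with ∈-∪⁻ {i = i} {P′} {Q′} i∈T | ∈-∪⁻ {i = j} {P′} {Q′} j∈T
      ... | inj₁ i∈P′ | inj₁ j∈P′ =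
        triangle-free y i j (proj₁ (proj₂ (others⁻ {y} {z} i∈P′)) , i~j , proj₁ (proj₂ (others⁻ {y} {z} j∈P′)))
      ... | inj₂ i∈Q′ | inj₂ j∈Q′ =
        triangle-free z i j (proj₁ (proj₂ (others⁻ {z} {y} i∈Q′)) , i~j , proj₁ (proj₂ (others⁻ {z} {y} j∈Q′)))
      ... | inj₁ i∈P′ | inj₂ j∈Q′ = rest-independent i j (P′-outside i∈P′) (Q′-outside j∈Q′) i~j
      ... | inj₂ i∈Q′ | inj₁ j∈P′ = rest-independent i j (Q′-outside i∈Q′) (P′-outside j∈P′) i~j

      y∉T : ¬ y ∈ T
      y∉T y∈T with ∈-∪⁻ {i = y} {P′} {Q′} y∈T
      ... | inj₁ y∈P′ = adjacent-distinct G (proj₁ (proj₂ (others⁻ {y} {z} y∈P′))) refl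
      ... | inj₂ y∈Q′ = proj₂ (proj₂ (others⁻ {z} {y} y∈Q′)) refl
      z∉T : ¬ z ∈ T
      z∉T z∈T with ∈-∪⁻ {i = z} {P′} {Q′} z∈T
      ... | inj₁ z∈P′ = proj₂ (proj₂ (others⁻ {y} {z} z∈P′)) refl
      ... | inj₂ z∈Q′ = adjacent-distinct G (proj₁ (proj₂ (others⁻ {z} {y} z∈Q′))) refl

      y∈J∖T : y ∈ J ∖ T
      y∈J∖T = ∈-∖ {P = J} {T} y∈J y∉T
      z∈J∖T∖y : z ∈ (J ∖ T) ∖ ｛ y ｝
      z∈J∖T∖y = ∈-∖-singleton {P = J ∖ T} (∈-∖ {P = J} {T} z∈J z∉T) (λ z≡y → y≢z (sym z≡y))

      e≤ : e G ≤ (sumOver P′ a + sumOver Q′ a) + ((a y + suc p) + ((a z + suc q) + sumOver R (deg G)))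
      e≤ = ≤-trans (cover-J T⊆J T-independent) (≤-reflexive (cong₂ _+_ (sumOver-split T-split a)
        (trans (sumOver-remove {P = J ∖ T} y∈J∖T (deg G)) (cong₂ _+_ (trans (deg-split y) (cong (a y +_) d-y))
          (trans (sumOver-remove {P = (J ∖ T) ∖ ｛ y ｝} z∈J∖T∖y (deg G))
                 (cong (_+ sumOver R (deg G)) (trans (deg-split z) (cong (a z +_) d-z))))))))

      K≡ : K ≡ suc (p + q + card R)
      K≡ = suc-injective (begin
        suc K                           ≡⟨ card-J-split T⊆J ⟩
        card T + card (J ∖ T)           ≡⟨ cong₂ _+_ (sumOver-split T-split (λ _ → 1))
                                             (trans (card-remove {P = J ∖ T} y∈J∖T)
                                               (cong suc (card-remove {P = (J ∖ T) ∖ ｛ y ｝} z∈J∖T∖y))) ⟩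
        (p + q) + suc (suc (card R))    ≡⟨ trans (+-suc (p + q) (suc (card R))) (cong suc (+-suc (p + q) (card R))) ⟩
        suc (suc (p + q + card R))      ∎)
        where open ≡-Reasoning

      -- Edges of J: E C C = 2 and E C J = d y + d z, so the vertex-cover
      -- identity gives E J J = 2 (p + q + 1).
      E-CC : E G C C ≡ 2
      E-CC = trans (E-splitˡ G (pair-split y≢z) C) (cong₂ _+_
        (trans (E-singleton G y C) (trans (sumOver-pair y≢z (A G y)) (cong₂ _+_ (cong 𝟙 (irrefl G y)) (cong 𝟙 y~z))))
        (trans (E-singleton G z C) (trans (sumOver-pair y≢z (A G z))
          (cong₂ _+_ (cong 𝟙 (adj-sym G y~z)) (cong 𝟙 (irrefl G z))))))

      E-JJ : E G J J ≡ 2 * suc (p + q)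
      E-JJ = +-cancelʳ-≡ 2 _ _ (begin
        E G J J + 2                  ≡⟨ cong (E G J J +_) E-CC ⟨
        E G J J + E G C C            ≡⟨ cover-identity G (pair-⊆ y∈J z∈J) rest-independent ⟩
        2 * E G C J                  ≡⟨ cong (2 *_) (trans (sumOver-pair y≢z (degIn G J)) (cong₂ _+_ d-y d-z)) ⟩
        2 * (suc p + suc q)          ≡⟨ regroup p q ⟩
        2 * suc (p + q) + 2          ∎)
        where
        open ≡-Reasoning
        regroup : ∀ p q → 2 * (suc p + suc q) ≡ 2 * suc (p + q) + 2
        regroup = solve-∀

      t≤p+q : t ≤ p + q
      t≤p+q = ≤-pred (subst (_≤ suc (p + q)) (+-comm t 1)
        (*-cancelˡ-≤ 2 (≤-trans (dense-E J card-J) (≤-reflexive E-JJ))))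

      bound : (∀ {c} → c ∈ J → d c ≤ t) → 2 * (t * t) < K → e G + t * t ≤ K * K + 1
      bound d≤t 2t²<K =
        caseC-arith {e G} {sumOver P′ a} {sumOver Q′ a} {a y} {a z} {p} {q} {sumOver R (deg G)} {card R} {t} {K}
          e≤ (others-bound y z) (others-bound z y) (a-large y∈J) (a-large z∈J) (deg-bound R)
          K≡ t≤p+q (subst (_≤ t) d-y (d≤t y∈J)) (subst (_≤ t) d-z (d≤t z∈J)) 2t²<K

    -- If every vertex of J has at most t neighbours in J: J has K + 1
    -- vertices, so it contains an edge yz, and either J ∖ {y, z} contains
    -- a second edge (case B, after orienting it) or it does not (case C).
    sparse-J : (∀ {c} → c ∈ J → d c ≤ t) → 2 * (t * t) < K → e G + t * t ≤ K * K + 1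
    sparse-J d≤t 2t²<K with edge-or-independent G J
    ... | inj₁ J-independent = contradiction J-independent (dense-not-independent card-J)
    ... | inj₂ (y , z , y∈J , z∈J , y~z) with edge-or-independent G (J ∖ (｛ y ｝ ∪ ｛ z ｝))
    ...   | inj₁ rest-independent = CaseC.bound y∈J z∈J y~z rest-independent d≤t 2t²<K
    ...   | inj₂ (q , q′ , q∈ , q′∈ , q~q′)
            with ∈-∖⁻ {P = J} {｛ y ｝ ∪ ｛ z ｝} q∈ | ∈-∖⁻ {P = J} {｛ y ｝ ∪ ｛ z ｝} q′∈
               | adj G y q in y?q
    ...     | q∈J , q∉yz | q′∈J , q′∉yz | false =
              caseB y∈J z∈J q∈J q′∈J y~z q~q′ y?q q∉yz q′∉yz d≤t 2t²<K
    ...     | q∈J , q∉yz | q′∈J , q′∉yz | true with adj G y q′ in y?q′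
    ...       | false = caseB y∈J z∈J q′∈J q∈J y~z (adj-sym G q~q′) y?q′ q′∉yz q∉yz d≤t 2t²<K
    ...       | true  = ⊥-elim (triangle-free y q q′ (y?q , q~q′ , y?q′))

    bound : 2 * (t * t) < K → e G + t * t ≤ K * K + 1
    bound 2t²<K with any? (λ c → (J c ≟ᵇ true) ×-dec (suc t ≤? d c))
    ... | yes (c , c∈J , t<dc) = caseA c∈J t<dc
    ... | no  no-c = sparse-J (λ {c} c∈J → ≮⇒≥ (λ t<dc → no-c (c , c∈J , t<dc))) 2t²<K

  main : 2 * (t * t) < K → e G + t * t ≤ K * K + 1
  main 2t²<K with any? (λ x → K ≤? deg G x)
  ... | yes (v , K≤deg) = MaxDegree.bound v (≤-antisym (deg≤K v) K≤deg) 2t²<K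
  ... | no  none        = low-degree 2t²<K (λ x → ≰⇒> (λ K≤deg → none (x , K≤deg)))

-- t² ≤ K², needed to move t² across the truncated subtraction.
square-below : ∀ {t K} → 2 * (t * t) < K → t * t ≤ K * K
square-below {t} {suc K} 2t²<K =
  ≤-trans (m≤m+n (t * t) (t * t + 0)) (≤-trans (<⇒≤ 2t²<K) (m≤m*n (suc K) (suc K)))

-- Lemma 3.4, with k = K + 1, so that G has 2k − 1 = 2K + 1 vertices.
lemma3p4 : (k t : ℕ) → 5 ≤ k → 1 ≤ t → 2 * (t * t) < k ∸ 1
    → (G : Graph (2 * k ∸ 1)) → TriangleFree G
    → (∀ (S : Subset (2 * k ∸ 1)) → ∣ S ∣ ≡ k → t + 1 ≤ edgesIn G S)
    → e G ≤ (k ∸ 1) * (k ∸ 1) ∸ t * t + 1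
lemma3p4 zero t () _ _ _ _ _
lemma3p4 (suc K) t _ _ 2t²<K G triangle-free dense =
  ≤-trans (m+n≤o⇒m≤o∸n (e G) (Dense.main G triangle-free K t n≡2K+1 dense 2t²<K))
          (≤-reflexive (+-∸-comm 1 (square-below {t} {K} 2t²<K)))
  where
  n≡2K+1 : 2 * suc K ∸ 1 ≡ K + suc K
  n≡2K+1 = cong (λ m → K + suc m) (+-identityʳ K)
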